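{- Let $h\ge 2$, $w=2h$, and let $n\in A_w$ have parameters $p(n)=(\alpha^1,\dots,\alpha^h)$ satisfying $0<\alpha^1\le 5$, $\alpha^1\ge\alpha^2+1$, $0<\alpha^s\le 4$ for $2\le s\le h$, and $2\alpha^h\le 2\alpha^{h-1}+1$. Then $p(K(n))=(10-2\alpha^h,\ 9-2\alpha^{h-1},\ \dots,\ 9-2\alpha^2,\ 10-2\alpha^1)$, i.e. the first parameter of $K(n)$ is $10-2\alpha^h$, the $s$-th is $9-2\alpha^{h-s+1}$ for $2\le s\le h-1$, and the $h$-th is $10-2\alpha^1$.
   Context: A $w$-digit number is a string of $w$ decimal digits (leading zeros allowed); $A_w$ is the set of those whose digits are not all identical. For a $w$-digit number $n$, $O_d(n)=x_1\dots x_w$ is obtained by sorting its digits in non-increasing order and $O_u(n)=x_w\dots x_1$ by sorting them in non-decreasing order; the Kaprekar map is $K(n)=O_d(n)-O_u(n)$, written as a $w$-digit string with leading zeros. With $h=\lfloor w/2\rfloor$, the parameters of a $w$-digit number $n$ are $p(n)=(\alpha^1,\dots,\alpha^h)$, $\alpha^s=x_s-x_{w-s+1}$ where $x_1\ge\dots\ge x_w$ are its sorted digits. -}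

module Defs where

open import Data.Nat using (ℕ; zero; suc; _+_; _*_; _∸_; _^_; _≤ᵇ_; _<_)
open import Data.Nat.DivMod using (_/_; _%_)
open import Data.Bool using (if_then_else_)
open import Data.Vec using (Vec; []; _∷_; reverse; lookup; foldl)
open import Data.Fin using (Fin)
open import Data.Product using (∃₂; _×_)
open import Relation.Binary.PropositionalEquality using (_≢_)

-- A w-digit number is a vector of w decimal digits (most significant first).
Digits : ℕ → Set
Digits w = Vec ℕ w

open import Data.Vec.Relation.Unary.All using (All)
IsDigits : ∀ {w} → Digits w → Set
IsDigits v = All (_< 10) v

-- A_w : digits not all identical
NotAllEqual : ∀ {w} → Digits w → Set
NotAllEqual {w} v = ∃₂ λ (i j : Fin w) → lookup v i ≢ lookup v j

insertDesc : ∀ {k} → ℕ → Vec ℕ k → Vec ℕ (suc k)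
insertDesc x [] = x ∷ []
insertDesc x (y ∷ ys) = if y ≤ᵇ x then x ∷ y ∷ ys else y ∷ insertDesc x ys

sortDesc : ∀ {k} → Vec ℕ k → Vec ℕ k
sortDesc [] = []
sortDesc (x ∷ xs) = insertDesc x (sortDesc xs)

Od : ∀ {w} → Digits w → Digits w
Od = sortDesc

Ou : ∀ {w} → Digits w → Digits w
Ou v = reverse (sortDesc v)

value : ∀ {w} → Digits w → ℕ
value = foldl _ (λ acc d → acc * 10 + d) 0

-- the w-digit string (with leading zeros) of m mod 10^w
toDigitsRev : (w : ℕ) → ℕ → Digits w
toDigitsRev zero m = []
toDigitsRev (suc w) m = (m % 10) ∷ toDigitsRev w (m / 10)

toDigits : (w : ℕ) → ℕ → Digits w
toDigits w m = reverse (toDigitsRev w m)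

K : ∀ {w} → Digits w → Digits w
K {w} v = toDigits w (value (Od v) ∸ value (Ou v))

-- s-th sorted digit x_s (1-indexed, x_1 ≥ … ≥ x_w); 0 outside range
nth : ∀ {k} → Vec ℕ k → ℕ → ℕ
nth [] _ = 0
nth (x ∷ xs) zero = 0
nth (x ∷ xs) (suc zero) = x
nth (x ∷ xs) (suc (suc s)) = nth xs (suc s)

sorted : ∀ {w} → Digits w → ℕ → ℕ
sorted v s = nth (Od v) s

-- parameter α^s(n) = x_s − x_{w−s+1}, meaningful for 1 ≤ s ≤ ⌊w/2⌋
α : ∀ {w} → Digits w → ℕ → ℕ
α {w} v s = sorted v s ∸ sorted v (w + 1 ∸ s)

-- Write the sorted digits x₁ ≥ … ≥ x₂ₕ of n as u = (x₁,…,xₕ) followed by the reverse of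
-- l = (x₂ₕ,…,xₕ₊₁), so that u = l + a componentwise with a = p(n). The contributions of l cancel
-- in O_d(n) − O_u(n), which equals 10ʰ·A − A′ where A has the digits α¹…αʰ and A′ the same
-- digits reversed. Borrowing 1 from the last digit of A and taking the ten's complement of A′
-- shows that K(n) has the digits α¹ … α^{h−1} (αʰ−1) (9−αʰ) (9−α^{h−1}) … (9−α²) (10−α¹).
-- Under the hypotheses the first half is non-increasing with digits ≤ 5 and the second half is
-- non-increasing (this is where α² < α¹ is used) with digits ≥ 5, so sorting K(n) swaps the
-- halves, and p(K(n)) is read off as differences of mirrored digits.

module Submission where

open import Defs
open import Data.Nat using (ℕ; zero; suc; _+_; _*_; _∸_; _^_; _⊓_; _≤_; _≥_; _<_; _≤ᵇ_; z≤n; s≤s)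
open import Data.Nat.Properties
open import Data.Nat.DivMod using (_/_; _%_; [m+kn]%n≡m%n; m<n⇒m%n≡m; +-distrib-/-∣ˡ; m*n/n≡m; m<n⇒m/n≡0)
open import Data.Nat.Divisibility using (n∣m*n)
open import Data.Nat.Tactic.RingSolver using (solve-∀)
open import Data.Bool using (true; false)
open import Data.Product using (_×_; _,_; proj₁; proj₂)
open import Data.Sum using (inj₁; inj₂)
open import Function using (flip; _∘_)
open import Data.List using (List; []; _∷_; _++_; _∷ʳ_; _ʳ++_; length; reverse; map; zipWith; foldl; foldr; take; drop)
import Data.List.Properties as List
open import Data.List.Relation.Unary.All as All using (All; []; _∷_)
import Data.List.Relation.Unary.All.Properties as All
import Data.List.Relation.Unary.AllPairs.Properties as AllPairs
open import Data.List.Relation.Unary.Linked as Linked using (Linked; []; [-]; _∷_)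
import Data.List.Relation.Unary.Linked.Properties as Linked
open import Data.List.Relation.Binary.Permutation.Propositional using (_↭_; ↭-sym; ↭-trans; ↭⇒↭ₛ)
open import Data.List.Relation.Binary.Permutation.Propositional.Properties using (All-resp-↭; ↭-reverse; ++-comm)
open import Data.List.Relation.Binary.Pointwise using (Pointwise-≡⇒≡)
open import Data.List.Relation.Unary.Sorted.TotalOrder.Properties using (↗↭↗⇒≋)
import Data.Vec as Vec
open import Data.Vec using (Vec; toList)
import Data.Vec.Properties as Vec
open import Relation.Binary.PropositionalEquality
open import Relation.Binary.Properties.DecTotalOrder ≤-decTotalOrder using (≥-decTotalOrder; ≥-totalOrder)
open import Data.List.Sort.InsertionSort.Base ≥-decTotalOrder using (insert; sort)
open import Data.List.Sort.InsertionSort.Properties ≥-decTotalOrder using (sort-↭; sort-↗)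
open ≡-Reasoning

at : List ℕ → ℕ → ℕ
at []       _             = 0
at (x ∷ xs) zero          = 0
at (x ∷ xs) (suc zero)    = x
at (x ∷ xs) (suc (suc s)) = at xs (suc s)

nth-toList : ∀ {k} (v : Vec ℕ k) s → nth v s ≡ at (toList v) s
nth-toList Vec.[]       s             = refl
nth-toList (x Vec.∷ v) zero          = refl
nth-toList (x Vec.∷ v) (suc zero)    = refl
nth-toList (x Vec.∷ v) (suc (suc s)) = nth-toList v (suc s)

at-∷ : ∀ x xs {s} → 1 ≤ s → at (x ∷ xs) (suc s) ≡ at xs s
at-∷ x xs {suc s} _ = refl

at-++ˡ : ∀ xs ys {s} → s ≤ length xs → at (xs ++ ys) s ≡ at xs s
at-++ˡ []       []       {zero}        _         = refl
at-++ˡ []       (y ∷ ys) {zero}        _         = refl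
at-++ˡ (x ∷ xs) ys       {zero}        _         = refl
at-++ˡ (x ∷ xs) ys       {suc zero}    _         = refl
at-++ˡ (x ∷ xs) ys       {suc (suc s)} (s≤s s≤) = at-++ˡ xs ys s≤

at-++ʳ : ∀ xs ys {s} → 1 ≤ s → at (xs ++ ys) (length xs + s) ≡ at ys s
at-++ʳ []            ys         _   = refl
at-++ʳ (x ∷ [])      ys {suc s} _   = refl
at-++ʳ (x ∷ x′ ∷ xs) ys {suc s} 1≤s = at-++ʳ (x′ ∷ xs) ys 1≤s

at-reverse : ∀ xs {s} → 1 ≤ s → s ≤ length xs → at (reverse xs) s ≡ at xs (length xs + 1 ∸ s)
at-reverse []       (s≤s _) ()
at-reverse (x ∷ xs) {s} 1≤s s≤1+|xs| rewrite List.unfold-reverse x xs with m≤n⇒m<n∨m≡n s≤1+|xs|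
... | inj₁ (s≤s s≤|xs|) = begin
  at (reverse xs ∷ʳ x) s                ≡⟨ at-++ˡ (reverse xs) _ (subst (s ≤_) (sym (List.length-reverse xs)) s≤|xs|) ⟩
  at (reverse xs) s                     ≡⟨ at-reverse xs 1≤s s≤|xs| ⟩
  at xs (length xs + 1 ∸ s)             ≡⟨ at-∷ x xs (m<n⇒0<n∸m (subst (s <_) (+-comm 1 (length xs)) (s≤s s≤|xs|))) ⟨
  at (x ∷ xs) (suc (length xs + 1 ∸ s)) ≡⟨ cong (at (x ∷ xs)) (+-∸-assoc 1 (m≤n⇒m≤n+o 1 s≤|xs|)) ⟨
  at (x ∷ xs) (suc (length xs) + 1 ∸ s) ∎
... | inj₂ refl = begin
  at (reverse xs ∷ʳ x) (suc (length xs))              ≡⟨ cong (at (reverse xs ∷ʳ x)) (+-comm 1 (length xs)) ⟩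
  at (reverse xs ∷ʳ x) (length xs + 1)                ≡⟨ cong (λ k → at (reverse xs ∷ʳ x) (k + 1)) (List.length-reverse xs) ⟨
  at (reverse xs ∷ʳ x) (length (reverse xs) + 1)      ≡⟨ at-++ʳ (reverse xs) (x ∷ []) (s≤s z≤n) ⟩
  x                                                   ≡⟨ cong (at (x ∷ xs)) (m+n∸m≡n (suc (length xs)) 1) ⟨
  at (x ∷ xs) (suc (length xs) + 1 ∸ suc (length xs)) ∎

at-map : ∀ (f : ℕ → ℕ) xs {s} → 1 ≤ s → s ≤ length xs → at (map f xs) s ≡ f (at xs s)
at-map f (x ∷ xs) {suc zero}    _ _         = refl
at-map f (x ∷ xs) {suc (suc s)} _ (s≤s s≤) = at-map f xs (s≤s z≤n) s≤

at-zipWith-∸ : ∀ xs ys s → length xs ≡ length ys → at (zipWith _∸_ xs ys) s ≡ at xs s ∸ at ys s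
at-zipWith-∸ []       []       s             _  = refl
at-zipWith-∸ (x ∷ xs) (y ∷ ys) zero          _  = refl
at-zipWith-∸ (x ∷ xs) (y ∷ ys) (suc zero)    _  = refl
at-zipWith-∸ (x ∷ xs) (y ∷ ys) (suc (suc s)) eq = at-zipWith-∸ xs ys (suc s) (suc-injective eq)

All-at⁺ : ∀ {P : ℕ → Set} xs → (∀ s → 1 ≤ s → s ≤ length xs → P (at xs s)) → All P xs
All-at⁺ []       _ = []
All-at⁺ (x ∷ xs) p = p 1 (s≤s z≤n) (s≤s z≤n) ∷ All-at⁺ xs λ where
  (suc s) _ s≤ → p (suc (suc s)) (s≤s z≤n) (s≤s s≤)

decHead : List ℕ → List ℕ
decHead []       = []
decHead (x ∷ xs) = x ∸ 1 ∷ xs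

length-decHead : ∀ xs → length (decHead xs) ≡ length xs
length-decHead []      = refl
length-decHead (_ ∷ _) = refl

at-decHead-1 : ∀ xs → at (decHead xs) 1 ≡ at xs 1 ∸ 1
at-decHead-1 []      = refl
at-decHead-1 (_ ∷ _) = refl

at-decHead : ∀ xs {s} → 2 ≤ s → at (decHead xs) s ≡ at xs s
at-decHead []      (s≤s (s≤s _)) = refl
at-decHead (_ ∷ _) (s≤s (s≤s _)) = refl

Linked-++⁻ : ∀ {R : ℕ → ℕ → Set} xs {ys} → Linked R (xs ++ ys) → Linked R xs × Linked R ys
Linked-++⁻ []           l       = [] , l
Linked-++⁻ (x ∷ [])     l       = [-] , Linked.tail l
Linked-++⁻ (x ∷ y ∷ xs) (r ∷ l) with Linked-++⁻ (y ∷ xs) l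
... | lxs , lys = r ∷ lxs , lys

Linked-ʳ++⁺ : ∀ {R : ℕ → ℕ → Set} {x xs ys} → Linked R (x ∷ xs) → Linked (flip R) (x ∷ ys) →
  Linked (flip R) ((x ∷ xs) ʳ++ ys)
Linked-ʳ++⁺ [-]     l = l
Linked-ʳ++⁺ (r ∷ p) l = Linked-ʳ++⁺ p (r ∷ l)

Linked-reverse⁺ : ∀ {R : ℕ → ℕ → Set} {xs} → Linked R xs → Linked (flip R) (reverse xs)
Linked-reverse⁺ {xs = []}    _ = []
Linked-reverse⁺ {xs = _ ∷ _} p = Linked-ʳ++⁺ p [-]

Linked-zipWith-∸ : ∀ {us ls} → Linked _≥_ us → Linked _≤_ ls → Linked _≥_ (zipWith _∸_ us ls)
Linked-zipWith-∸ {[]}             _         _         = []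
Linked-zipWith-∸ {_ ∷ _} {[]}     _         _         = []
Linked-zipWith-∸ {_ ∷ []} {_ ∷ _} _         _         = [-]
Linked-zipWith-∸ {_ ∷ _ ∷ _} {_ ∷ []} _     _         = [-]
Linked-zipWith-∸ {_ ∷ _ ∷ _} {_ ∷ _ ∷ _} (r ∷ p) (q ∷ l) = ∸-mono r q ∷ Linked-zipWith-∸ p l

decHead-asc : ∀ {xs} → Linked _≤_ xs → Linked _≤_ (decHead xs)
decHead-asc []      = []
decHead-asc [-]     = [-]
decHead-asc (r ∷ p) = ≤-trans (m∸n≤m _ 1) r ∷ p

decHead-desc : ∀ {xs} → Linked _≥_ xs → at xs 2 < at xs 1 → Linked _≥_ (decHead xs)
decHead-desc []      _  = []
decHead-desc [-]     _  = [-]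
decHead-desc {x ∷ y ∷ _} (_ ∷ p) y<x = m+n≤o⇒m≤o∸n y (subst (_≤ x) (+-comm 1 y) y<x) ∷ p

All≤-decHead : ∀ {b xs} → All (_≤ b) xs → All (_≤ b) (decHead xs)
All≤-decHead []       = []
All≤-decHead (p ∷ ps) = ≤-trans (m∸n≤m _ 1) p ∷ ps

All-reverse⁺ : ∀ {P : ℕ → Set} {xs} → All P xs → All P (reverse xs)
All-reverse⁺ {xs = xs} = All-resp-↭ (↭-sym (↭-reverse xs))

toList-insertDesc : ∀ {k} x (v : Vec ℕ k) → toList (insertDesc x v) ≡ insert x (toList v)
toList-insertDesc x Vec.[]       = refl
toList-insertDesc x (y Vec.∷ v) with y ≤ᵇ x
... | true  = refl
... | false = cong (y ∷_) (toList-insertDesc x v)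

toList-Od : ∀ {w} (v : Digits w) → toList (Od v) ≡ sort (toList v)
toList-Od Vec.[]       = refl
toList-Od (x Vec.∷ v) = trans (toList-insertDesc x (sortDesc v)) (cong (insert x) (toList-Od v))

Od-desc : ∀ {w} (v : Digits w) → Linked _≥_ (toList (Od v))
Od-desc v = subst (Linked _≥_) (sym (toList-Od v)) (sort-↗ (toList v))

Od-↭ : ∀ {w} (v : Digits w) → toList (Od v) ↭ toList v
Od-↭ v = subst (_↭ toList v) (sym (toList-Od v)) (sort-↭ (toList v))

desc-unique : ∀ {xs ys} → Linked _≥_ xs → Linked _≥_ ys → xs ↭ ys → xs ≡ ys
desc-unique xs↘ ys↘ xs↭ys = Pointwise-≡⇒≡ (↗↭↗⇒≋ ≥-totalOrder xs↘ ys↘ (↭⇒↭ₛ xs↭ys))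

toList-Od-++ : ∀ {w} (v : Digits w) t {xs ys} → toList v ≡ xs ++ ys →
  Linked _≥_ xs → Linked _≥_ ys → All (_≤ t) xs → All (t ≤_) ys → toList (Od v) ≡ ys ++ xs
toList-Od-++ v t {xs} {ys} v≡xs++ys xs↘ ys↘ xs≤t t≤ys = desc-unique (Od-desc v) ys++xs↘
  (↭-trans (Od-↭ v) (subst (_↭ ys ++ xs) (sym v≡xs++ys) (++-comm xs ys)))
  where
  ys++xs↘ : Linked _≥_ (ys ++ xs)
  ys++xs↘ = Linked.AllPairs⇒Linked (AllPairs.++⁺ (Linked.Linked⇒AllPairs (flip ≤-trans) ys↘)
    (Linked.Linked⇒AllPairs (flip ≤-trans) xs↘) (All.map (λ t≤y → All.map (λ x≤t → ≤-trans x≤t t≤y) xs≤t) t≤ys))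

-- Little-endian values of digit lists

valueLE : List ℕ → ℕ
valueLE = foldr (λ d acc → acc * 10 + d) 0

foldl-toList : ∀ {k} (f : ℕ → ℕ → ℕ) acc (v : Vec ℕ k) → Vec.foldl (λ _ → ℕ) f acc v ≡ foldl f acc (toList v)
foldl-toList f acc Vec.[]       = refl
foldl-toList f acc (x Vec.∷ v) = foldl-toList f (f acc x) v

value-toList : ∀ {w} (v : Digits w) → value v ≡ valueLE (reverse (toList v))
value-toList v = trans (foldl-toList _ 0 v) (sym (List.reverse-foldr _ 0 (toList v)))

valueLE-++ : ∀ xs ys → valueLE (xs ++ ys) ≡ valueLE ys * 10 ^ length xs + valueLE xs
valueLE-++ []       ys = sym (trans (cong (_+ 0) (*-identityʳ (valueLE ys))) (+-identityʳ (valueLE ys)))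
valueLE-++ (x ∷ xs) ys = begin
  valueLE (xs ++ ys) * 10 + x                              ≡⟨ cong (λ v → v * 10 + x) (valueLE-++ xs ys) ⟩
  (valueLE ys * 10 ^ length xs + valueLE xs) * 10 + x      ≡⟨ shift (valueLE ys) (10 ^ length xs) (valueLE xs) x ⟩
  valueLE ys * (10 * 10 ^ length xs) + (valueLE xs * 10 + x) ∎
  where
  shift : ∀ a p b c → (a * p + b) * 10 + c ≡ a * (10 * p) + (b * 10 + c)
  shift = solve-∀

valueLE-zipWith-+ : ∀ xs ys → length xs ≡ length ys → valueLE (zipWith _+_ xs ys) ≡ valueLE xs + valueLE ys
valueLE-zipWith-+ []       []       _  = refl
valueLE-zipWith-+ (x ∷ xs) (y ∷ ys) eq = begin
  valueLE (zipWith _+_ xs ys) * 10 + (x + y)      ≡⟨ cong (λ v → v * 10 + (x + y)) (valueLE-zipWith-+ xs ys (suc-injective eq)) ⟩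
  (valueLE xs + valueLE ys) * 10 + (x + y)        ≡⟨ regroup (valueLE xs) (valueLE ys) x y ⟩
  (valueLE xs * 10 + x) + (valueLE ys * 10 + y)   ∎
  where
  regroup : ∀ a b x y → (a + b) * 10 + (x + y) ≡ (a * 10 + x) + (b * 10 + y)
  regroup = solve-∀

zipWith-∷ʳ : ∀ (f : ℕ → ℕ → ℕ) xs ys x y → length xs ≡ length ys →
  zipWith f (xs ∷ʳ x) (ys ∷ʳ y) ≡ zipWith f xs ys ∷ʳ f x y
zipWith-∷ʳ f []        []        x y _  = refl
zipWith-∷ʳ f (x′ ∷ xs) (y′ ∷ ys) x y eq = cong (f x′ y′ ∷_) (zipWith-∷ʳ f xs ys x y (suc-injective eq))

reverse-zipWith : ∀ (f : ℕ → ℕ → ℕ) xs ys → length xs ≡ length ys →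
  reverse (zipWith f xs ys) ≡ zipWith f (reverse xs) (reverse ys)
reverse-zipWith f []       []       _  = refl
reverse-zipWith f (x ∷ xs) (y ∷ ys) eq = begin
  reverse (f x y ∷ zipWith f xs ys)                      ≡⟨ List.unfold-reverse (f x y) (zipWith f xs ys) ⟩
  reverse (zipWith f xs ys) ∷ʳ f x y                     ≡⟨ cong (_∷ʳ f x y) (reverse-zipWith f xs ys (suc-injective eq)) ⟩
  zipWith f (reverse xs) (reverse ys) ∷ʳ f x y           ≡⟨ zipWith-∷ʳ f (reverse xs) (reverse ys) x y |rev-xs|≡|rev-ys| ⟨
  zipWith f (reverse xs ∷ʳ x) (reverse ys ∷ʳ y)          ≡⟨ cong₂ (zipWith f) (List.unfold-reverse x xs) (List.unfold-reverse y ys) ⟨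
  zipWith f (reverse (x ∷ xs)) (reverse (y ∷ ys))        ∎
  where
  |rev-xs|≡|rev-ys| : length (reverse xs) ≡ length (reverse ys)
  |rev-xs|≡|rev-ys| = trans (List.length-reverse xs) (trans (suc-injective eq) (sym (List.length-reverse ys)))

valueLE-nines-complement : ∀ xs → All (_≤ 9) xs → valueLE xs + valueLE (map (9 ∸_) xs) + 1 ≡ 10 ^ length xs
valueLE-nines-complement []       []         = refl
valueLE-nines-complement (x ∷ xs) (x≤9 ∷ ps) = begin
  valueLE xs * 10 + x + (valueLE (map (9 ∸_) xs) * 10 + (9 ∸ x)) + 1 ≡⟨ regroup (valueLE xs) (valueLE (map (9 ∸_) xs)) x (9 ∸ x) ⟩
  (valueLE xs + valueLE (map (9 ∸_) xs)) * 10 + (x + (9 ∸ x)) + 1   ≡⟨ cong (λ d → (valueLE xs + valueLE (map (9 ∸_) xs)) * 10 + d + 1) (m+[n∸m]≡n x≤9) ⟩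
  (valueLE xs + valueLE (map (9 ∸_) xs)) * 10 + 9 + 1               ≡⟨ carry (valueLE xs + valueLE (map (9 ∸_) xs)) ⟩
  10 * (valueLE xs + valueLE (map (9 ∸_) xs) + 1)                   ≡⟨ cong (10 *_) (valueLE-nines-complement xs ps) ⟩
  10 * 10 ^ length xs                                               ∎
  where
  regroup : ∀ a b x y → a * 10 + x + (b * 10 + y) + 1 ≡ (a + b) * 10 + (x + y) + 1
  regroup = solve-∀
  carry : ∀ c → c * 10 + 9 + 1 ≡ 10 * (c + 1)
  carry = solve-∀

valueLE-decHead : ∀ xs → 1 ≤ at xs 1 → valueLE (decHead xs) + 1 ≡ valueLE xs
valueLE-decHead (x ∷ xs) 1≤x = trans (+-assoc (valueLE xs * 10) (x ∸ 1) 1) (cong (valueLE xs * 10 +_) (m∸n+n≡m 1≤x))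

[m*10+d]%10≡d : ∀ m {d} → d < 10 → (m * 10 + d) % 10 ≡ d
[m*10+d]%10≡d m {d} d<10 = trans (cong (_% 10) (+-comm (m * 10) d)) (trans ([m+kn]%n≡m%n d m 10) (m<n⇒m%n≡m d<10))

[m*10+d]/10≡m : ∀ m {d} → d < 10 → (m * 10 + d) / 10 ≡ m
[m*10+d]/10≡m m {d} d<10 = begin
  (m * 10 + d) / 10      ≡⟨ +-distrib-/-∣ˡ d (n∣m*n m) ⟩
  m * 10 / 10 + d / 10   ≡⟨ cong₂ _+_ (m*n/n≡m m 10) (m<n⇒m/n≡0 d<10) ⟩
  m + 0                  ≡⟨ +-identityʳ m ⟩
  m                      ∎

toList-toDigitsRev : ∀ ds → All (_< 10) ds → toList (toDigitsRev (length ds) (valueLE ds)) ≡ ds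
toList-toDigitsRev []       []          = refl
toList-toDigitsRev (d ∷ ds) (d<10 ∷ ps) = cong₂ _∷_ ([m*10+d]%10≡d (valueLE ds) d<10)
  (trans (cong (toList ∘ toDigitsRev (length ds)) ([m*10+d]/10≡m (valueLE ds) d<10)) (toList-toDigitsRev ds ps))

toList-toDigits : ∀ {w} ds → length ds ≡ w → All (_< 10) ds → toList (toDigits w (valueLE (reverse ds))) ≡ ds
toList-toDigits ds refl ds<10 = begin
  toList (Vec.reverse (toDigitsRev (length ds) (valueLE (reverse ds))))         ≡⟨ Vec.toList-reverse (toDigitsRev (length ds) _) ⟩
  reverse (toList (toDigitsRev (length ds) (valueLE (reverse ds))))             ≡⟨ cong (λ k → reverse (toList (toDigitsRev k (valueLE (reverse ds))))) (List.length-reverse ds) ⟨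
  reverse (toList (toDigitsRev (length (reverse ds)) (valueLE (reverse ds))))   ≡⟨ cong reverse (toList-toDigitsRev (reverse ds) (All-reverse⁺ ds<10)) ⟩
  reverse (reverse ds)                                                          ≡⟨ List.reverse-involutive ds ⟩
  ds                                                                            ∎

-- The difference O_d(n) − O_u(n)

valueLE-++-reverse-zipWith-+ : ∀ l a → length l ≡ length a →
  valueLE (l ++ reverse (zipWith _+_ l a)) + valueLE a
    ≡ valueLE (zipWith _+_ l a ++ reverse l) + valueLE (reverse a) * 10 ^ length a
valueLE-++-reverse-zipWith-+ l a |l|≡|a| = begin
  valueLE (l ++ reverse u) + valueLE a                                        ≡⟨ cong (_+ valueLE a) (valueLE-++ l (reverse u)) ⟩
  valueLE (reverse u) * 10 ^ length l + valueLE l + valueLE a                 ≡⟨ cong₂ (λ v k → v * 10 ^ k + valueLE l + valueLE a) reverse-linear |l|≡|a| ⟩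
  (valueLE (reverse l) + valueLE (reverse a)) * P + valueLE l + valueLE a     ≡⟨ regroup (valueLE (reverse l)) (valueLE (reverse a)) (valueLE l) (valueLE a) P ⟩
  valueLE (reverse l) * P + (valueLE l + valueLE a) + valueLE (reverse a) * P ≡⟨ cong₂ (λ k v → valueLE (reverse l) * 10 ^ k + v + valueLE (reverse a) * P)
                                                                                   |u|≡|a| (valueLE-zipWith-+ l a |l|≡|a|) ⟨
  valueLE (reverse l) * 10 ^ length u + valueLE u + valueLE (reverse a) * P   ≡⟨ cong (_+ valueLE (reverse a) * P) (valueLE-++ u (reverse l)) ⟨
  valueLE (u ++ reverse l) + valueLE (reverse a) * P                          ∎
  where
  u = zipWith _+_ l a
  P = 10 ^ length a
  |u|≡|a| : length u ≡ length a
  |u|≡|a| = trans (List.length-zipWith _+_ l a) (trans (cong (_⊓ length a) |l|≡|a|) (⊓-idem (length a)))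
  reverse-linear : valueLE (reverse u) ≡ valueLE (reverse l) + valueLE (reverse a)
  reverse-linear = trans (cong valueLE (reverse-zipWith _+_ l a |l|≡|a|))
    (valueLE-zipWith-+ (reverse l) (reverse a) (trans (List.length-reverse l) (trans |l|≡|a| (sym (List.length-reverse a)))))
  regroup : ∀ r s m n p → (r + s) * p + m + n ≡ r * p + (m + n) + s * p
  regroup = solve-∀

-- For a = (α¹,…,αʰ): α¹ … α^{h−1} (αʰ−1)  and  (9−αʰ) (9−α^{h−1}) … (9−α²) (10−α¹).
leading trailing : List ℕ → List ℕ
leading a  = reverse (decHead (reverse a))
trailing a = map (9 ∸_) (reverse (decHead a))

length-leading : ∀ a → length (leading a) ≡ length a
length-leading a = trans (List.length-reverse (decHead (reverse a))) (trans (length-decHead (reverse a)) (List.length-reverse a))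

length-trailing : ∀ a → length (trailing a) ≡ length a
length-trailing a = trans (List.length-map (9 ∸_) (reverse (decHead a))) (trans (List.length-reverse (decHead a)) (length-decHead a))

reverse-leading++trailing : ∀ a → reverse (leading a ++ trailing a) ≡ map (9 ∸_) (decHead a) ++ decHead (reverse a)
reverse-leading++trailing a = begin
  reverse (leading a ++ trailing a)                                  ≡⟨ List.reverse-++ (leading a) (trailing a) ⟩
  reverse (trailing a) ++ reverse (leading a)                        ≡⟨ cong₂ _++_ (List.reverse-map (9 ∸_) (reverse (decHead a)))
                                                                          (sym (List.reverse-involutive (decHead (reverse a)))) ⟨
  map (9 ∸_) (reverse (reverse (decHead a))) ++ decHead (reverse a)  ≡⟨ cong (λ xs → map (9 ∸_) xs ++ decHead (reverse a)) (List.reverse-involutive (decHead a)) ⟩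
  map (9 ∸_) (decHead a) ++ decHead (reverse a)                      ∎

leading-desc : ∀ {a} → Linked _≥_ a → Linked _≥_ (leading a)
leading-desc a↘ = Linked-reverse⁺ (decHead-asc (Linked-reverse⁺ a↘))

trailing-desc : ∀ {a} → Linked _≥_ (decHead a) → Linked _≥_ (trailing a)
trailing-desc decHead-a↘ = Linked.map⁺ (Linked.map (∸-monoʳ-≤ 9) (Linked-reverse⁺ decHead-a↘))

leading≤ : ∀ {a b} → All (_≤ b) a → All (_≤ b) (leading a)
leading≤ a≤b = All-reverse⁺ (All≤-decHead (All-reverse⁺ a≤b))

5≤trailing : ∀ {a} → All (_≤ 4) (decHead a) → All (5 ≤_) (trailing a)
5≤trailing decHead-a≤4 = All.map⁺ (All.map (∸-monoʳ-≤ 9) (All-reverse⁺ decHead-a≤4))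

at-trailing : ∀ a {s} → 1 ≤ s → s ≤ length a → at (trailing a) s ≡ 9 ∸ at (decHead a) (length a + 1 ∸ s)
at-trailing a {s} 1≤s s≤|a| = begin
  at (map (9 ∸_) (reverse (decHead a))) s             ≡⟨ at-map (9 ∸_) (reverse (decHead a)) 1≤s (subst (s ≤_) (sym |rev-da|≡|a|) s≤|a|) ⟩
  9 ∸ at (reverse (decHead a)) s                      ≡⟨ cong (9 ∸_) (at-reverse (decHead a) 1≤s (subst (s ≤_) (sym (length-decHead a)) s≤|a|)) ⟩
  9 ∸ at (decHead a) (length (decHead a) + 1 ∸ s)     ≡⟨ cong (λ k → 9 ∸ at (decHead a) (k + 1 ∸ s)) (length-decHead a) ⟩
  9 ∸ at (decHead a) (length a + 1 ∸ s)               ∎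
  where
  |rev-da|≡|a| : length (reverse (decHead a)) ≡ length a
  |rev-da|≡|a| = trans (List.length-reverse (decHead a)) (length-decHead a)

valueLE-reverse-leading++trailing : ∀ a → 1 ≤ at a 1 → 1 ≤ at (reverse a) 1 → All (_≤ 9) (decHead a) →
  valueLE (reverse (leading a ++ trailing a)) + valueLE a ≡ valueLE (reverse a) * 10 ^ length a
valueLE-reverse-leading++trailing a 1≤a₁ 1≤aₕ decHead-a≤9 = begin
  valueLE (reverse (leading a ++ trailing a)) + valueLE a ≡⟨ cong₂ _+_ (trans (cong valueLE (reverse-leading++trailing a)) (valueLE-++ C _))
                                                               (sym (valueLE-decHead a 1≤a₁)) ⟩
  D * 10 ^ length C + valueLE C + (E + 1)                 ≡⟨ cong (λ k → D * 10 ^ k + valueLE C + (E + 1)) |C|≡|a| ⟩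
  D * P + valueLE C + (E + 1)                             ≡⟨ regroup D P (valueLE C) E ⟩
  D * P + (E + valueLE C + 1)                             ≡⟨ cong (D * P +_) (trans (valueLE-nines-complement (decHead a) decHead-a≤9)
                                                               (cong (10 ^_) (length-decHead a))) ⟩
  D * P + P                                               ≡⟨ factor D P ⟩
  (D + 1) * P                                             ≡⟨ cong (_* P) (valueLE-decHead (reverse a) 1≤aₕ) ⟩
  valueLE (reverse a) * P                                 ∎
  where
  C = map (9 ∸_) (decHead a)
  D = valueLE (decHead (reverse a))
  E = valueLE (decHead a)
  P = 10 ^ length a
  |C|≡|a| : length C ≡ length a
  |C|≡|a| = trans (List.length-map (9 ∸_) (decHead a)) (length-decHead a)
  regroup : ∀ d p c e → d * p + c + (e + 1) ≡ d * p + (e + c + 1)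
  regroup = solve-∀
  factor : ∀ d p → d * p + p ≡ (d + 1) * p
  factor = solve-∀

kaprekar-difference : ∀ l a → length l ≡ length a → 1 ≤ at a 1 → 1 ≤ at (reverse a) 1 → All (_≤ 9) (decHead a) →
  valueLE (l ++ reverse (zipWith _+_ l a)) ≡ valueLE (zipWith _+_ l a ++ reverse l) + valueLE (reverse (leading a ++ trailing a))
kaprekar-difference l a |l|≡|a| 1≤a₁ 1≤aₕ decHead-a≤9 = +-cancelʳ-≡ (valueLE a) _ _ (begin
  valueLE (l ++ reverse u) + valueLE a                   ≡⟨ valueLE-++-reverse-zipWith-+ l a |l|≡|a| ⟩
  valueLE (u ++ reverse l) + valueLE (reverse a) * 10 ^ length a
                                                         ≡⟨ cong (valueLE (u ++ reverse l) +_) (valueLE-reverse-leading++trailing a 1≤a₁ 1≤aₕ decHead-a≤9) ⟨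
  valueLE (u ++ reverse l) + (valueLE (reverse E) + valueLE a) ≡⟨ +-assoc (valueLE (u ++ reverse l)) (valueLE (reverse E)) (valueLE a) ⟨
  valueLE (u ++ reverse l) + valueLE (reverse E) + valueLE a ∎)
  where
  u = zipWith _+_ l a
  E = leading a ++ trailing a

value-Ou : ∀ {w} (v : Digits w) → value (Ou v) ≡ valueLE (toList (Od v))
value-Ou v = begin
  value (Vec.reverse (Od v))                      ≡⟨ value-toList (Vec.reverse (Od v)) ⟩
  valueLE (reverse (toList (Vec.reverse (Od v)))) ≡⟨ cong (valueLE ∘ reverse) (Vec.toList-reverse (Od v)) ⟩
  valueLE (reverse (reverse (toList (Od v))))     ≡⟨ cong valueLE (List.reverse-involutive (toList (Od v))) ⟩
  valueLE (toList (Od v))                         ∎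

reverse-++-reverse : ∀ (xs ys : List ℕ) → reverse (xs ++ reverse ys) ≡ ys ++ reverse xs
reverse-++-reverse xs ys = trans (List.reverse-++ xs (reverse ys)) (cong (_++ reverse xs) (List.reverse-involutive ys))

toList-K : ∀ {h} (n : Digits (h + h)) l a → length l ≡ h → length a ≡ h →
  toList (Od n) ≡ zipWith _+_ l a ++ reverse l →
  1 ≤ at a 1 → 1 ≤ at (reverse a) 1 → All (_≤ 9) a → toList (K n) ≡ leading a ++ trailing a
toList-K {h} n l a |l|≡h |a|≡h Od≡ 1≤a₁ 1≤aₕ a≤9 = begin
  toList (K n)                                    ≡⟨ cong (toList ∘ toDigits (h + h)) difference ⟩
  toList (toDigits (h + h) (valueLE (reverse E))) ≡⟨ toList-toDigits E |E|≡h+h E<10 ⟩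
  E                                               ∎
  where
  u = zipWith _+_ l a
  E = leading a ++ trailing a
  decHead-a≤9 : All (_≤ 9) (decHead a)
  decHead-a≤9 = All≤-decHead a≤9
  difference : value (Od n) ∸ value (Ou n) ≡ valueLE (reverse E)
  difference = begin
    value (Od n) ∸ value (Ou n)                                   ≡⟨ cong₂ _∸_ (value-toList (Od n)) (value-Ou n) ⟩
    valueLE (reverse (toList (Od n))) ∸ valueLE (toList (Od n))   ≡⟨ cong (λ X → valueLE (reverse X) ∸ valueLE X) Od≡ ⟩
    valueLE (reverse (u ++ reverse l)) ∸ valueLE (u ++ reverse l) ≡⟨ cong (λ X → valueLE X ∸ valueLE (u ++ reverse l)) (reverse-++-reverse u l) ⟩
    valueLE (l ++ reverse u) ∸ valueLE (u ++ reverse l)           ≡⟨ cong (_∸ valueLE (u ++ reverse l))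
                                                                       (kaprekar-difference l a (trans |l|≡h (sym |a|≡h)) 1≤a₁ 1≤aₕ decHead-a≤9) ⟩
    valueLE (u ++ reverse l) + valueLE (reverse E) ∸ valueLE (u ++ reverse l) ≡⟨ m+n∸m≡n (valueLE (u ++ reverse l)) (valueLE (reverse E)) ⟩
    valueLE (reverse E)                                           ∎
  |E|≡h+h : length E ≡ h + h
  |E|≡h+h = trans (List.length-++ (leading a)) (cong₂ _+_ (trans (length-leading a) |a|≡h) (trans (length-trailing a) |a|≡h))
  E<10 : All (_< 10) E
  E<10 = All.++⁺ (All.map s≤s (leading≤ a≤9)) (All.map⁺ (All.map (λ {x} _ → s≤s (m∸n≤m 9 x)) (All-reverse⁺ decHead-a≤9)))

-- Parameters of n and of K(n)

9∸m∸[m∸1]≡10∸2*m : ∀ {m} → 1 ≤ m → 9 ∸ m ∸ (m ∸ 1) ≡ 10 ∸ 2 * m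
9∸m∸[m∸1]≡10∸2*m {suc k} _ = trans (∸-+-assoc 9 (suc k) k) (cong (9 ∸_) (regroup k))
  where
  regroup : ∀ k → suc k + k ≡ k + suc (k + 0)
  regroup = solve-∀

9∸m∸m≡9∸2*m : ∀ m → 9 ∸ m ∸ m ≡ 9 ∸ 2 * m
9∸m∸m≡9∸2*m m = trans (∸-+-assoc 9 m m) (cong (λ k → 9 ∸ (m + k)) (sym (+-identityʳ m)))

9∸[m∸1]∸m≡10∸2*m : ∀ {m} → 1 ≤ m → 9 ∸ (m ∸ 1) ∸ m ≡ 10 ∸ 2 * m
9∸[m∸1]∸m≡10∸2*m {suc k} _ = trans (∸-+-assoc 9 k (suc k)) (cong (λ j → 9 ∸ (k + suc j)) (sym (+-identityʳ k)))

reflect-bounds : ∀ {h s} → 1 ≤ s → s ≤ h → 1 ≤ h + 1 ∸ s × h + 1 ∸ s ≤ h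
reflect-bounds {h} {s} 1≤s s≤h =
  m<n⇒0<n∸m (subst (s <_) (+-comm 1 h) (s≤s s≤h)) ,
  ≤-trans (∸-monoʳ-≤ (h + 1) 1≤s) (≤-reflexive (m+n∸n≡m h 1))

at-mirror : ∀ u l {h s} → length u ≡ h → length l ≡ h → 1 ≤ s → s ≤ h →
  at (u ++ reverse l) s ∸ at (u ++ reverse l) (h + h + 1 ∸ s) ≡ at u s ∸ at l s
at-mirror u l {h} {s} refl |l|≡h 1≤s s≤h = cong₂ _∸_ (at-++ˡ u (reverse l) s≤h) (begin
  at (u ++ reverse l) (h + h + 1 ∸ s)   ≡⟨ cong (at (u ++ reverse l)) (trans (cong (_∸ s) (+-assoc h h 1)) (+-∸-assoc h s≤h+1)) ⟩
  at (u ++ reverse l) (h + (h + 1 ∸ s)) ≡⟨ at-++ʳ u (reverse l) 1≤h+1∸s ⟩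
  at (reverse l) (h + 1 ∸ s)            ≡⟨ at-reverse l 1≤h+1∸s (subst (h + 1 ∸ s ≤_) (sym |l|≡h) h+1∸s≤h) ⟩
  at l (length l + 1 ∸ (h + 1 ∸ s))    ≡⟨ cong (λ k → at l (k + 1 ∸ (h + 1 ∸ s))) |l|≡h ⟩
  at l (h + 1 ∸ (h + 1 ∸ s))           ≡⟨ cong (at l) (m∸[m∸n]≡n s≤h+1) ⟩
  at l s                               ∎)
  where
  s≤h+1 : s ≤ h + 1
  s≤h+1 = m≤n⇒m≤n+o 1 s≤h
  1≤h+1∸s : 1 ≤ h + 1 ∸ s
  1≤h+1∸s = proj₁ (reflect-bounds 1≤s s≤h)
  h+1∸s≤h : h + 1 ∸ s ≤ h
  h+1∸s≤h = proj₂ (reflect-bounds 1≤s s≤h)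

α-mirror : ∀ {h} (n : Digits (h + h)) u l → toList (Od n) ≡ u ++ reverse l → length u ≡ h → length l ≡ h →
  ∀ s → 1 ≤ s → s ≤ h → α n s ≡ at u s ∸ at l s
α-mirror {h} n u l Od≡ |u|≡h |l|≡h s 1≤s s≤h = begin
  α n s                                                       ≡⟨ cong₂ _∸_ (nth-toList (Od n) s) (nth-toList (Od n) (h + h + 1 ∸ s)) ⟩
  at (toList (Od n)) s ∸ at (toList (Od n)) (h + h + 1 ∸ s)  ≡⟨ cong (λ xs → at xs s ∸ at xs (h + h + 1 ∸ s)) Od≡ ⟩
  at (u ++ reverse l) s ∸ at (u ++ reverse l) (h + h + 1 ∸ s) ≡⟨ at-mirror u l |u|≡h |l|≡h 1≤s s≤h ⟩
  at u s ∸ at l s                                             ∎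

zipWith-+-∸ : ∀ us ls → length us ≡ length ls → All (0 <_) (zipWith _∸_ us ls) → zipWith _+_ ls (zipWith _∸_ us ls) ≡ us
zipWith-+-∸ []       []       _  _        = refl
zipWith-+-∸ (x ∷ us) (y ∷ ls) eq (p ∷ ps) =
  cong₂ _∷_ (m+[n∸m]≡n {y} (<⇒≤ (m∸n≢0⇒n<m (λ x∸y≡0 → <⇒≢ p (sym x∸y≡0))))) (zipWith-+-∸ us ls (suc-injective eq) ps)

module Parameters {h : ℕ} (n : Digits (h + h)) where

  upper lower params : List ℕ
  upper  = take h (toList (Od n))
  lower  = reverse (drop h (toList (Od n)))
  params = zipWith _∸_ upper lower

  Od≡upper++reverse-lower : toList (Od n) ≡ upper ++ reverse lower
  Od≡upper++reverse-lower = trans (sym (List.take++drop≡id h (toList (Od n))))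
    (cong (upper ++_) (sym (List.reverse-involutive (drop h (toList (Od n))))))

  length-upper : length upper ≡ h
  length-upper = trans (List.length-take h (toList (Od n)))
    (trans (cong (h ⊓_) (Vec.length-toList (Od n))) (m≤n⇒m⊓n≡m (m≤m+n h h)))

  length-lower : length lower ≡ h
  length-lower = trans (List.length-reverse (drop h (toList (Od n))))
    (trans (List.length-drop h (toList (Od n))) (trans (cong (_∸ h) (Vec.length-toList (Od n))) (m+n∸m≡n h h)))

  length-params : length params ≡ h
  length-params = trans (List.length-zipWith _∸_ upper lower) (trans (cong₂ _⊓_ length-upper length-lower) (⊓-idem h))

  α≡at-params : ∀ s → 1 ≤ s → s ≤ h → α n s ≡ at params s
  α≡at-params s 1≤s s≤h = trans (α-mirror n upper lower Od≡upper++reverse-lower length-upper length-lower s 1≤s s≤h)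
    (sym (at-zipWith-∸ upper lower s (trans length-upper (sym length-lower))))

  at-reverse-params : ∀ s → 1 ≤ s → s ≤ h → at (reverse params) s ≡ α n (h + 1 ∸ s)
  at-reverse-params s 1≤s s≤h = begin
    at (reverse params) s                ≡⟨ at-reverse params 1≤s (subst (s ≤_) (sym length-params) s≤h) ⟩
    at params (length params + 1 ∸ s)    ≡⟨ cong (λ k → at params (k + 1 ∸ s)) length-params ⟩
    at params (h + 1 ∸ s)                ≡⟨ α≡at-params (h + 1 ∸ s) (proj₁ (reflect-bounds 1≤s s≤h)) (proj₂ (reflect-bounds 1≤s s≤h)) ⟨
    α n (h + 1 ∸ s)                      ∎

  params-desc : Linked _≥_ params
  params-desc with Linked-++⁻ upper (subst (Linked _≥_) Od≡upper++reverse-lower (Od-desc n))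
  ... | upper↘ , reverse-lower↘ = Linked-zipWith-∸ upper↘ (subst (Linked _≤_) (List.reverse-involutive lower) (Linked-reverse⁺ reverse-lower↘))

module KaprekarStep {h : ℕ} (2≤h : 2 ≤ h) (n : Digits (h + h))
  (0<α¹ : 0 < α n 1) (α¹≤5 : α n 1 ≤ 5) (α²<α¹ : α n 2 + 1 ≤ α n 1)
  (αˢ-bounds : ∀ s → 2 ≤ s → s ≤ h → 0 < α n s × α n s ≤ 4) where

  open Parameters {h} n

  1≤h : 1 ≤ h
  1≤h = ≤-trans (s≤s z≤n) 2≤h

  params-bounds : ∀ s → 1 ≤ s → s ≤ length params → 0 < at params s × at params s ≤ 5
  params-bounds 1 _ _ = subst (λ x → 0 < x × x ≤ 5) (α≡at-params 1 ≤-refl 1≤h) (0<α¹ , α¹≤5)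
  params-bounds s@(suc (suc _)) 1≤s s≤|params| with αˢ-bounds s (s≤s (s≤s z≤n)) (subst (s ≤_) length-params s≤|params|)
  ... | 0<αˢ , αˢ≤4 = subst (λ x → 0 < x × x ≤ 5) (α≡at-params s 1≤s (subst (s ≤_) length-params s≤|params|)) (0<αˢ , m≤n⇒m≤1+n αˢ≤4)

  ≤|decHead-params|⇒≤h : ∀ {s} → s ≤ length (decHead params) → s ≤ h
  ≤|decHead-params|⇒≤h {s} = subst (s ≤_) (trans (length-decHead params) length-params)

  decHead-params≤4 : All (_≤ 4) (decHead params)
  decHead-params≤4 = All-at⁺ (decHead params) λ where
    1 _ _ → subst (_≤ 4) (sym (at-decHead-1 params)) (∸-monoˡ-≤ 1 (proj₂ (params-bounds 1 ≤-refl (subst (1 ≤_) (sym length-params) 1≤h))))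
    s@(suc (suc _)) 1≤s s≤|dp| → subst (_≤ 4) (trans (α≡at-params s 1≤s (≤|decHead-params|⇒≤h s≤|dp|)) (sym (at-decHead params (s≤s (s≤s z≤n)))))
      (proj₂ (αˢ-bounds s (s≤s (s≤s z≤n)) (≤|decHead-params|⇒≤h s≤|dp|)))

  params-bounded : All (λ x → 0 < x × x ≤ 5) params
  params-bounded = All-at⁺ params params-bounds

  Od≡lower+params : toList (Od n) ≡ zipWith _+_ lower params ++ reverse lower
  Od≡lower+params = trans Od≡upper++reverse-lower
    (cong (_++ reverse lower) (sym (zipWith-+-∸ upper lower (trans length-upper (sym length-lower)) (All.map proj₁ params-bounded))))

  K-digits : toList (K n) ≡ leading params ++ trailing params
  K-digits = toList-K n lower params length-lower length-params Od≡lower+params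
    (subst (1 ≤_) (α≡at-params 1 ≤-refl 1≤h) 0<α¹)
    (subst (1 ≤_) (trans (cong (α n) (sym (m+n∸n≡m h 1))) (sym (at-reverse-params 1 ≤-refl 1≤h))) (proj₁ (αˢ-bounds h 2≤h ≤-refl)))
    (All.map (λ b → ≤-trans (proj₂ b) (m≤n⇒m≤n+o 4 ≤-refl)) params-bounded)

  Od-K-digits : toList (Od (K n)) ≡ trailing params ++ leading params
  Od-K-digits = toList-Od-++ (K n) 5 K-digits
    (leading-desc params-desc) (trailing-desc (decHead-desc params-desc params₂<params₁))
    (leading≤ (All.map proj₂ params-bounded)) (5≤trailing decHead-params≤4)
    where
    params₂<params₁ : at params 2 < at params 1
    params₂<params₁ = subst₂ (λ x y → suc x ≤ y) (α≡at-params 2 (s≤s z≤n) 2≤h) (α≡at-params 1 ≤-refl 1≤h)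
      (subst (_≤ α n 1) (+-comm (α n 2) 1) α²<α¹)

  α-K : ∀ s → 1 ≤ s → s ≤ h → α (K n) s ≡ 9 ∸ at (decHead params) (h + 1 ∸ s) ∸ at (decHead (reverse params)) s
  α-K s 1≤s s≤h = begin
    α (K n) s
      ≡⟨ α-mirror (K n) (trailing params) (decHead (reverse params)) Od-K-digits
                  |trailing-params|≡h |decHead-reverse-params|≡h s 1≤s s≤h ⟩
    at (trailing params) s ∸ at (decHead (reverse params)) s
      ≡⟨ cong (_∸ at (decHead (reverse params)) s) (at-trailing params 1≤s (subst (s ≤_) (sym length-params) s≤h)) ⟩
    9 ∸ at (decHead params) (length params + 1 ∸ s) ∸ at (decHead (reverse params)) s
      ≡⟨ cong (λ k → 9 ∸ at (decHead params) (k + 1 ∸ s) ∸ at (decHead (reverse params)) s) length-params ⟩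
    9 ∸ at (decHead params) (h + 1 ∸ s) ∸ at (decHead (reverse params)) s
      ∎
    where
    |trailing-params|≡h : length (trailing params) ≡ h
    |trailing-params|≡h = trans (length-trailing params) length-params
    |decHead-reverse-params|≡h : length (decHead (reverse params)) ≡ h
    |decHead-reverse-params|≡h = trans (length-decHead (reverse params)) (trans (List.length-reverse params) length-params)

  at-decHead-params : ∀ s → 2 ≤ s → s ≤ h → at (decHead params) s ≡ α n s
  at-decHead-params s 2≤s s≤h = trans (at-decHead params 2≤s) (sym (α≡at-params s (≤-trans (s≤s z≤n) 2≤s) s≤h))

  at-decHead-reverse-params : ∀ s → 2 ≤ s → s ≤ h → at (decHead (reverse params)) s ≡ α n (h + 1 ∸ s)
  at-decHead-reverse-params s 2≤s s≤h = trans (at-decHead (reverse params) 2≤s) (at-reverse-params s (≤-trans (s≤s z≤n) 2≤s) s≤h)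

  α-K-first : α (K n) 1 ≡ 9 ∸ α n h ∸ (α n h ∸ 1)
  α-K-first = begin
    α (K n) 1
      ≡⟨ α-K 1 ≤-refl 1≤h ⟩
    9 ∸ at (decHead params) (h + 1 ∸ 1) ∸ at (decHead (reverse params)) 1
      ≡⟨ cong₂ (λ i x → 9 ∸ at (decHead params) i ∸ x) (m+n∸n≡m h 1) (at-decHead-1 (reverse params)) ⟩
    9 ∸ at (decHead params) h ∸ (at (reverse params) 1 ∸ 1)
      ≡⟨ cong₂ (λ x y → 9 ∸ x ∸ (y ∸ 1)) (at-decHead-params h 2≤h ≤-refl) (at-reverse-params 1 ≤-refl 1≤h) ⟩
    9 ∸ α n h ∸ (α n (h + 1 ∸ 1) ∸ 1)
      ≡⟨ cong (λ i → 9 ∸ α n h ∸ (α n i ∸ 1)) (m+n∸n≡m h 1) ⟩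
    9 ∸ α n h ∸ (α n h ∸ 1)
      ∎

  α-K-middle : ∀ s → 2 ≤ s → s ≤ h ∸ 1 → α (K n) s ≡ 9 ∸ α n (h + 1 ∸ s) ∸ α n (h + 1 ∸ s)
  α-K-middle s 2≤s s≤h∸1 = begin
    α (K n) s
      ≡⟨ α-K s 1≤s s≤h ⟩
    9 ∸ at (decHead params) (h + 1 ∸ s) ∸ at (decHead (reverse params)) s
      ≡⟨ cong₂ (λ x y → 9 ∸ x ∸ y) (at-decHead-params (h + 1 ∸ s) 2≤h+1∸s (proj₂ (reflect-bounds 1≤s s≤h)))
                                   (at-decHead-reverse-params s 2≤s s≤h) ⟩
    9 ∸ α n (h + 1 ∸ s) ∸ α n (h + 1 ∸ s)
      ∎
    where
    1≤s : 1 ≤ s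
    1≤s = ≤-trans (s≤s z≤n) 2≤s
    s≤h : s ≤ h
    s≤h = ≤-trans s≤h∸1 (m∸n≤m h 1)
    2≤h+1∸s : 2 ≤ h + 1 ∸ s
    2≤h+1∸s = m+n≤o⇒m≤o∸n 2 2+s≤h+1
      where
      2+s≤h+1 : 2 + s ≤ h + 1
      2+s≤h+1 = ≤-trans (+-monoʳ-≤ 2 s≤h∸1) (≤-reflexive (trans (cong suc (m+[n∸m]≡n 1≤h)) (+-comm 1 h)))

  α-K-last : α (K n) h ≡ 9 ∸ (α n 1 ∸ 1) ∸ α n 1
  α-K-last = begin
    α (K n) h
      ≡⟨ α-K h 1≤h ≤-refl ⟩
    9 ∸ at (decHead params) (h + 1 ∸ h) ∸ at (decHead (reverse params)) h
      ≡⟨ cong₂ (λ i x → 9 ∸ at (decHead params) i ∸ x) (m+n∸m≡n h 1) (at-decHead-reverse-params h 2≤h ≤-refl) ⟩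
    9 ∸ at (decHead params) 1 ∸ α n (h + 1 ∸ h)
      ≡⟨ cong₂ (λ x i → 9 ∸ x ∸ α n i) (at-decHead-1 params) (m+n∸m≡n h 1) ⟩
    9 ∸ (at params 1 ∸ 1) ∸ α n 1
      ≡⟨ cong (λ x → 9 ∸ (x ∸ 1) ∸ α n 1) (α≡at-params 1 ≤-refl 1≤h) ⟨
    9 ∸ (α n 1 ∸ 1) ∸ α n 1
      ∎

mainTheorem6 : (h : ℕ) → 2 ≤ h → (n : Digits (h + h)) → IsDigits n → NotAllEqual n →
    0 < α n 1 → α n 1 ≤ 5 → α n 2 + 1 ≤ α n 1 →
    (∀ s → 2 ≤ s → s ≤ h → 0 < α n s × α n s ≤ 4) →
    2 * α n h ≤ 2 * α n (h ∸ 1) + 1 →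
    (α (K n) 1 ≡ 10 ∸ 2 * α n h)
    × (∀ s → 2 ≤ s → s ≤ h ∸ 1 → α (K n) s ≡ 9 ∸ 2 * α n (h + 1 ∸ s))
    × (α (K n) h ≡ 10 ∸ 2 * α n 1)
mainTheorem6 h 2≤h n _ _ 0<α¹ α¹≤5 α²<α¹ αˢ-bounds _ =
  trans α-K-first (9∸m∸[m∸1]≡10∸2*m (proj₁ (αˢ-bounds h 2≤h ≤-refl))) ,
  (λ s 2≤s s≤h∸1 → trans (α-K-middle s 2≤s s≤h∸1) (9∸m∸m≡9∸2*m (α n (h + 1 ∸ s)))) ,
  trans α-K-last (9∸[m∸1]∸m≡10∸2*m 0<α¹)
  where
  open KaprekarStep 2≤h n 0<α¹ α¹≤5 α²<α¹ αˢ-bounds
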